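{- Let $A$ and $B$ be commutative unital rings and $f:A\to B$ a unital ring morphism. Let $n\in\mathbb{N}^*$ and let $(a_1,\ldots,a_n)\in A^n$ be a $\lambda$-quiddity over $A$. (i) $(f(a_1),\ldots,f(a_n))\in B^n$ is a $\lambda$-quiddity over $B$. (ii) If moreover $(f(a_1),\ldots,f(a_n))$ is an irreducible $\lambda$-quiddity over $B$, then $(a_1,\ldots,a_n)$ is an irreducible $\lambda$-quiddity over $A$.
   Context: For a commutative unital ring $A$ and $a_1,\ldots,a_n\in A$, set $M_n(a_1,\ldots,a_n)=\begin{pmatrix}a_n&-1\\1&0\end{pmatrix}\cdots\begin{pmatrix}a_1&-1\\1&0\end{pmatrix}$. An $n$-tuple $(a_1,\ldots,a_n)\in A^n$ is a $\lambda$-quiddity over $A$ of size $n$ if $M_n(a_1,\ldots,a_n)=\pm Id$. For $(a_1,\ldots,a_n)\in A^n$, $(b_1,\ldots,b_m)\in A^m$ define $(a_1,\ldots,a_n)\oplus(b_1,\ldots,b_m)=(a_1+b_m,a_2,\ldots,a_{n-1},a_n+b_1,b_2,\ldots,b_{m-1})$. Write $(a_1,\ldots,a_n)\sim(b_1,\ldots,b_n)$ if $(b_1,\ldots,b_n)$ is obtained by a cyclic permutation of $(a_1,\ldots,a_n)$ or of $(a_n,\ldots,a_1)$. A $\lambda$-quiddity $(c_1,\ldots,c_n)$ with $n\ge3$ is reducible if there exist a $\lambda$-quiddity $(b_1,\ldots,b_l)$ and $(a_1,\ldots,a_m)\in A^m$ with $m,l\ge3$ and $(c_1,\ldots,c_n)\sim(a_1,\ldots,a_m)\oplus(b_1,\ldots,b_l)$;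 otherwise it is irreducible. The tuple $(0,0)$ is considered reducible. -}

module Defs where

open import Level using (Level)
open import Data.Nat using (ℕ; zero; suc; _≤_)
open import Data.List using (List; []; _∷_; _++_; length; reverse; map; [_])
open import Data.List.Relation.Binary.Pointwise using (Pointwise)
open import Data.Product using (Σ; _×_; _,_; ∃; ∃-syntax)
open import Data.Sum using (_⊎_)
open import Relation.Nullary using (¬_)
open import Algebra.Bundles using (CommutativeRing)

module Quiddity {c ℓ : Level} (R : CommutativeRing c ℓ) where
  open CommutativeRing R

  record Mat : Set c where
    constructor mat
    field
      m11 m12 m21 m22 : Carrier
  open Mat public

  _·_ : Mat → Mat → Mat
  mat a b c' d · mat e f g h =
    mat (a * e + b * g) (a * f + b * h) (c' * e + d * g) (c' * f + d * h)

  Id : Mat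
  Id = mat 1# 0# 0# 1#

  S : Carrier → Mat
  S a = mat a (- 1#) 1# 0#

  _≈M_ : Mat → Mat → Set ℓ
  mat a b c' d ≈M mat e f g h = (a ≈ e) × (b ≈ f) × (c' ≈ g) × (d ≈ h)

  negM : Mat → Mat
  negM (mat a b c' d) = mat (- a) (- b) (- c') (- d)

  -- M (a₁ ∷ … ∷ aₙ ∷ []) = S aₙ · … · S a₁  (and Id for the empty tuple)
  Mfrom : Mat → List Carrier → Mat
  Mfrom acc []       = acc
  Mfrom acc (a ∷ as) = Mfrom (S a · acc) as

  M : List Carrier → Mat
  M = Mfrom Id

  IsQuiddity : List Carrier → Set ℓ
  IsQuiddity as = (M as ≈M Id) ⊎ (M as ≈M negM Id)

  splitLast : Carrier → List Carrier → List Carrier × Carrier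
  splitLast x []       = ([] , x)
  splitLast x (y ∷ ys) with splitLast y ys
  ... | (i , l) = (x ∷ i , l)

  -- (a₁,…,aₘ) ⊕ (b₁,…,bₗ) = (a₁+bₗ, a₂,…,aₘ₋₁, aₘ+b₁, b₂,…,bₗ₋₁)
  -- (only used for m, l ≥ 3; the value on shorter inputs is irrelevant)
  _⊕_ : List Carrier → List Carrier → List Carrier
  (a₁ ∷ a₂ ∷ as) ⊕ (b₁ ∷ b₂ ∷ bs) with splitLast a₂ as | splitLast b₂ bs
  ... | (ai , am) | (bi , bl) = (a₁ + bl) ∷ (ai ++ ((am + b₁) ∷ bi))
  _ ⊕ _ = []

  rot : List Carrier → List Carrier
  rot []       = []
  rot (x ∷ xs) = xs ++ [ x ]

  rotN : ℕ → List Carrier → List Carrier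
  rotN zero    xs = xs
  rotN (suc k) xs = rot (rotN k xs)

  _≈L_ : List Carrier → List Carrier → Set (c Level.⊔ ℓ)
  _≈L_ = Pointwise _≈_

  _∼_ : List Carrier → List Carrier → Set (c Level.⊔ ℓ)
  as ∼ bs = ∃[ k ] ((bs ≈L rotN k as) ⊎ (bs ≈L rotN k (reverse as)))

  Reducible : List Carrier → Set (c Level.⊔ ℓ)
  Reducible cs =
    ( (3 ≤ length cs)
    × (Σ (List Carrier) λ as → Σ (List Carrier) λ bs →
         (3 ≤ length as) × (3 ≤ length bs) × IsQuiddity bs × (cs ∼ (as ⊕ bs))) )
    ⊎ (cs ≈L (0# ∷ 0# ∷ []))

  IsIrreducibleQuiddity : List Carrier → Set (c Level.⊔ ℓ)
  IsIrreducibleQuiddity cs = IsQuiddity cs × ¬ Reducible cs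

open Quiddity public using ()

{-# OPTIONS --safe #-}
module Submission where

-- A ring morphism f acts entrywise on 2×2 matrices and commutes with products,
-- so it sends M(a₁,…,aₙ) to M(f a₁,…,f aₙ) and ±Id to ±Id.  It also commutes
-- with ⊕, rotations and reversal, so it sends every reduction of (a₁,…,aₙ)
-- to a reduction of (f a₁,…,f aₙ); irreducibility therefore lifts back along f.

open import Defs
open import Level using (Level)
open import Data.Nat using (zero; suc; _≤_)
open import Data.List using (List; []; _∷_; [_]; length; map; reverse)
open import Data.List.Properties using (map-++; length-map; reverse-map)
open import Data.List.Relation.Binary.Pointwise as Pointwise using ([]; _∷_)
open import Data.Product using (_×_; _,_; proj₁; proj₂; map₂)
open import Data.Sum as Sum using (inj₁; inj₂)
open import Relation.Binary.Bundles using (Setoid)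
open import Relation.Binary.PropositionalEquality as ≡ using (_≡_)
open import Algebra.Bundles using (CommutativeRing)
open import Algebra.Morphism.Structures using (module RingMorphisms)

module MatProperties {c ℓ : Level} (R : CommutativeRing c ℓ) where
  open CommutativeRing R
  open Quiddity R

  Mat-setoid : Setoid c ℓ
  Mat-setoid = record
    { Carrier       = Mat
    ; _≈_           = _≈M_
    ; isEquivalence = record { refl = ≈M-refl ; sym = ≈M-sym ; trans = ≈M-trans }
    }
    where
    ≈M-refl : ∀ {X} → X ≈M X
    ≈M-refl {mat _ _ _ _} = refl , refl , refl , refl

    ≈M-sym : ∀ {X Y} → X ≈M Y → Y ≈M X
    ≈M-sym {mat _ _ _ _} {mat _ _ _ _} (p , q , r , s) = sym p , sym q , sym r , sym s

    ≈M-trans : ∀ {X Y Z} → X ≈M Y → Y ≈M Z → X ≈M Z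
    ≈M-trans {mat _ _ _ _} {mat _ _ _ _} {mat _ _ _ _} (p , q , r , s) (p′ , q′ , r′ , s′) =
      trans p p′ , trans q q′ , trans r r′ , trans s s′

  negM-cong : ∀ {X Y} → X ≈M Y → negM X ≈M negM Y
  negM-cong {mat _ _ _ _} {mat _ _ _ _} (p , q , r , s) =
    -‿cong p , -‿cong q , -‿cong r , -‿cong s

  ·-cong : ∀ {X X′ Y Y′} → X ≈M X′ → Y ≈M Y′ → (X · Y) ≈M (X′ · Y′)
  ·-cong {mat _ _ _ _} {mat _ _ _ _} {mat _ _ _ _} {mat _ _ _ _}
         (p , q , r , s) (p′ , q′ , r′ , s′) =
    dot p q p′ r′ , dot p q q′ s′ , dot r s p′ r′ , dot r s q′ s′
    where
    dot : ∀ {x x′ y y′ u u′ v v′} → x ≈ x′ → y ≈ y′ → u ≈ u′ → v ≈ v′ →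
          x * u + y * v ≈ x′ * u′ + y′ * v′
    dot x≈ y≈ u≈ v≈ = +-cong (*-cong x≈ u≈) (*-cong y≈ v≈)

module MapProperties
    {a ℓa b ℓb : Level} (A : CommutativeRing a ℓa) (B : CommutativeRing b ℓb)
    (f : CommutativeRing.Carrier A → CommutativeRing.Carrier B)
    (hom : RingMorphisms.IsRingHomomorphism
             (CommutativeRing.rawRing A) (CommutativeRing.rawRing B) f) where
  private
    module A = CommutativeRing A
    module B = CommutativeRing B
    module QA = Quiddity A
    module QB = Quiddity B
  open RingMorphisms.IsRingHomomorphism hom
  open MatProperties B using (Mat-setoid; ·-cong; negM-cong)
  open Setoid Mat-setoid using (sym)
  open import Relation.Binary.Reasoning.Setoid Mat-setoid

  mapMat : QA.Mat → QB.Mat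
  mapMat (QA.mat p q r s) = QB.mat (f p) (f q) (f r) (f s)

  mapMat-cong : ∀ {X Y} → X QA.≈M Y → mapMat X QB.≈M mapMat Y
  mapMat-cong {QA.mat _ _ _ _} {QA.mat _ _ _ _} (p , q , r , s) =
    ⟦⟧-cong p , ⟦⟧-cong q , ⟦⟧-cong r , ⟦⟧-cong s

  mapMat-· : ∀ X Y → mapMat (X QA.· Y) QB.≈M (mapMat X QB.· mapMat Y)
  mapMat-· (QA.mat x y z w) (QA.mat p q r s) =
    dot-homo x y p r , dot-homo x y q s , dot-homo z w p r , dot-homo z w q s
    where
    dot-homo : ∀ x y u v → f (x A.* u A.+ y A.* v) B.≈ f x B.* f u B.+ f y B.* f v
    dot-homo x y u v = B.trans (+-homo _ _) (B.+-cong (*-homo x u) (*-homo y v))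

  mapMat-S : ∀ x → mapMat (QA.S x) QB.≈M QB.S (f x)
  mapMat-S x = B.refl , B.trans (-‿homo A.1#) (B.-‿cong 1#-homo) , 1#-homo , 0#-homo

  mapMat-Id : mapMat QA.Id QB.≈M QB.Id
  mapMat-Id = 1#-homo , 0#-homo , 0#-homo , 1#-homo

  mapMat-negM : ∀ X → mapMat (QA.negM X) QB.≈M QB.negM (mapMat X)
  mapMat-negM (QA.mat p q r s) = -‿homo p , -‿homo q , -‿homo r , -‿homo s

  Mfrom-map : ∀ xs {acc accB} → accB QB.≈M mapMat acc →
              QB.Mfrom accB (map f xs) QB.≈M mapMat (QA.Mfrom acc xs)
  Mfrom-map []       accB≈ = accB≈
  Mfrom-map (x ∷ xs) {acc} {accB} accB≈ = Mfrom-map xs (begin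
    QB.S (f x) QB.· accB            ≈⟨ ·-cong (sym (mapMat-S x)) accB≈ ⟩
    mapMat (QA.S x) QB.· mapMat acc ≈⟨ mapMat-· (QA.S x) acc ⟨
    mapMat (QA.S x QA.· acc)        ∎)

  M-map : ∀ xs → QB.M (map f xs) QB.≈M mapMat (QA.M xs)
  M-map xs = Mfrom-map xs (sym mapMat-Id)

  map-IsQuiddity : ∀ xs → QA.IsQuiddity xs → QB.IsQuiddity (map f xs)
  map-IsQuiddity xs (inj₁ M≈Id) = inj₁ (begin
    QB.M (map f xs)   ≈⟨ M-map xs ⟩
    mapMat (QA.M xs)  ≈⟨ mapMat-cong M≈Id ⟩
    mapMat QA.Id      ≈⟨ mapMat-Id ⟩
    QB.Id             ∎)
  map-IsQuiddity xs (inj₂ M≈-Id) = inj₂ (begin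
    QB.M (map f xs)           ≈⟨ M-map xs ⟩
    mapMat (QA.M xs)          ≈⟨ mapMat-cong M≈-Id ⟩
    mapMat (QA.negM QA.Id)    ≈⟨ mapMat-negM QA.Id ⟩
    QB.negM (mapMat QA.Id)    ≈⟨ negM-cong mapMat-Id ⟩
    QB.negM QB.Id             ∎)

  splitLast-map : ∀ x xs → QB.splitLast (f x) (map f xs) ≡
                  (map f (proj₁ (QA.splitLast x xs)) , f (proj₂ (QA.splitLast x xs)))
  splitLast-map x []       = ≡.refl
  splitLast-map x (y ∷ ys) rewrite splitLast-map y ys with QA.splitLast y ys
  ... | _ = ≡.refl

  private
    ≡⇒≈L : ∀ {xs ys} → xs ≡ ys → xs QB.≈L ys
    ≡⇒≈L ≡.refl = Pointwise.refl B.refl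

  map-⊕ : ∀ xs ys → map f (xs QA.⊕ ys) QB.≈L (map f xs QB.⊕ map f ys)
  map-⊕ []             _              = []
  map-⊕ (_ ∷ [])       _              = []
  map-⊕ (_ ∷ _ ∷ _)    []             = []
  map-⊕ (_ ∷ _ ∷ _)    (_ ∷ [])       = []
  map-⊕ (a₁ ∷ a₂ ∷ as) (b₁ ∷ b₂ ∷ bs)
    rewrite splitLast-map a₂ as | splitLast-map b₂ bs
    with QA.splitLast a₂ as | QA.splitLast b₂ bs
  ... | (ai , am) | (bi , bl) =
    +-homo a₁ bl ∷ Pointwise.transitive B.trans (≡⇒≈L (map-++ f ai _))
                     (Pointwise.++⁺ (Pointwise.refl B.refl)
                                    (+-homo am b₁ ∷ Pointwise.refl B.refl))

  rotN-map : ∀ k xs → QB.rotN k (map f xs) ≡ map f (QA.rotN k xs)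
  rotN-map zero    xs = ≡.refl
  rotN-map (suc k) xs = ≡.trans (≡.cong QB.rot (rotN-map k xs)) (rot-map (QA.rotN k xs))
    where
    rot-map : ∀ xs → QB.rot (map f xs) ≡ map f (QA.rot xs)
    rot-map []       = ≡.refl
    rot-map (x ∷ xs) = ≡.sym (map-++ f xs [ x ])

  map-≈L : ∀ {xs ys} → xs QA.≈L ys → map f xs QB.≈L map f ys
  map-≈L xs≈ys = Pointwise.map⁺ f f (Pointwise.map ⟦⟧-cong xs≈ys)

  private
    ≈L-≡ : ∀ {ds es es′} → ds QA.≈L es → es′ ≡ map f es → map f ds QB.≈L es′
    ≈L-≡ ds≈es ≡.refl = map-≈L ds≈es

  map-∼ : ∀ {cs ds} → cs QA.∼ ds → map f cs QB.∼ map f ds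
  map-∼ {cs} (k , inj₁ ds≈) = k , inj₁ (≈L-≡ ds≈ (rotN-map k cs))
  map-∼ {cs} (k , inj₂ ds≈) = k , inj₂ (≈L-≡ ds≈ rotN-reverse-map)
    where
    rotN-reverse-map : QB.rotN k (reverse (map f cs)) ≡ map f (QA.rotN k (reverse cs))
    rotN-reverse-map = ≡.trans (≡.cong (QB.rotN k) (≡.sym (reverse-map f cs)))
                               (rotN-map k (reverse cs))

  map-Reducible : ∀ cs → QA.Reducible cs → QB.Reducible (map f cs)
  map-Reducible cs (inj₁ (3≤cs , xs , ys , 3≤xs , 3≤ys , ys-quid , cs∼xs⊕ys)) =
    inj₁ ( length-≤ cs 3≤cs , map f xs , map f ys , length-≤ xs 3≤xs , length-≤ ys 3≤ys
         , map-IsQuiddity ys ys-quid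
         , map₂ (Sum.map ⊕-map-≈L ⊕-map-≈L) (map-∼ cs∼xs⊕ys) )
    where
    length-≤ : ∀ {n} xs → n ≤ length xs → n ≤ length (map f xs)
    length-≤ xs n≤ = ≡.subst (_ ≤_) (≡.sym (length-map f xs)) n≤
    ⊕-map-≈L : ∀ {es} → map f (xs QA.⊕ ys) QB.≈L es → (map f xs QB.⊕ map f ys) QB.≈L es
    ⊕-map-≈L = Pointwise.transitive B.trans (Pointwise.symmetric B.sym (map-⊕ xs ys))
  map-Reducible cs (inj₂ (c₁≈0 ∷ c₂≈0 ∷ [])) =
    inj₂ (B.trans (⟦⟧-cong c₁≈0) 0#-homo ∷ B.trans (⟦⟧-cong c₂≈0) 0#-homo ∷ [])

proposition3p1 : ∀ {a ℓa b ℓb : Level} (A : CommutativeRing a ℓa) (B : CommutativeRing b ℓb)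
    (f : CommutativeRing.Carrier A → CommutativeRing.Carrier B) →
    RingMorphisms.IsRingHomomorphism (CommutativeRing.rawRing A) (CommutativeRing.rawRing B) f →
    (as : List (CommutativeRing.Carrier A)) → 1 ≤ length as →
    Quiddity.IsQuiddity A as →
    Quiddity.IsQuiddity B (map f as)
    × (Quiddity.IsIrreducibleQuiddity B (map f as) → Quiddity.IsIrreducibleQuiddity A as)
proposition3p1 A B f hom as _ as-quid =
  map-IsQuiddity as as-quid ,
  λ (_ , map-irreducible) → as-quid , λ red → map-irreducible (map-Reducible as red)
  where open MapProperties A B f hom
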